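{- Let $n,r$ be integers with $0\le r<n$ and $\gcd(r,n)=1$, and let $T\subset\mathbb{R}^2$ be the closed triangle with vertices $(0,0)$, $(1,0)$ and $(r,n)$. If $\mathbf{u}$ is a visible lattice point lying in $T$, then there is a perfect matching $\omega$ of $\hat B(n,r)$ such that $h_{\omega_0}(\omega)=\mathbf{u}$.
   Context: $B(n,r)$ is the bipartite periodic graph embedded in $\mathbb{R}^2$ with black vertices at the points $(i/n,j)$ and white vertices at the points $((2i+1)/(2n),j)$, $i,j\in\mathbb{Z}$, in which each white vertex $((2i+1)/(2n),j)$ is joined (by a straight segment) to exactly the three black vertices $(i/n,j)$, $((i+1)/n,j)$ and $((i+r)/n,j+1)$. $\hat B(n,r)$ is its projection on the torus $\mathbb{T}^2=\mathbb{R}^2/\mathbb{Z}^2$. The base perfect matching $\omega_0$ consists of the edges of the first type (white $((2i+1)/(2n),j)$ to black $(i/n,j)$). Edges are oriented from white to black. For a perfect matching $\omega$ of $\hat B(n,r)$, the transition graph $\omega-\omega_0$ consists of the edges of $\omega$ with their orientation and the edges of $\omega_0$ reversed, discarding pairs of vertices joined in both directions; it is an oriented 1-cycle on the torus and $h_{\omega_0}(\omega)\in\mathbb{Z}^2=H_1(\mathbb{T}^2;\mathbb{Z})$ is its homology class. A point $\mathbf{u}=(u_1,u_2)\in\mathbb{Z}^2$ is a visible lattice point if $\mathbf{u}=\mathbf{0}$ or $\gcd(u_1,u_2)=1$. -}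

module Defs where

open import Data.Nat as ℕ using (ℕ; zero; suc; NonZero)
open import Data.Nat.DivMod using (_%_; m%n<n)
open import Data.Nat.GCD using (gcd)
open import Data.Fin using (Fin; toℕ; fromℕ<)
open import Data.Integer as ℤ using (ℤ; +_; -_; _-_; ∣_∣)
open import Data.Product using (Σ; _×_; _,_)
open import Data.Sum using (_⊎_)
open import Relation.Binary.PropositionalEquality using (_≡_)

-- Points of ℤ² = H₁(𝕋²; ℤ)
ℤ² : Set
ℤ² = ℤ × ℤ

_+²_ : ℤ² → ℤ² → ℤ²
(a , b) +² (c , d) = (a ℤ.+ c , b ℤ.+ d)

_-²_ : ℤ² → ℤ² → ℤ²
(a , b) -² (c , d) = (a - c , b - d)

_·²_ : ℤ → ℤ² → ℤ²
k ·² (a , b) = (k ℤ.* a , k ℤ.* b)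

sumFin : (n : ℕ) → (Fin n → ℤ²) → ℤ²
sumFin zero    f = (+ 0 , + 0)
sumFin (suc n) f = f Data.Fin.zero +² sumFin n (λ i → f (Data.Fin.suc i))

Visible : ℤ² → Set
Visible (u₁ , u₂) = ((u₁ , u₂) ≡ (+ 0 , + 0)) ⊎ (gcd ∣ u₁ ∣ ∣ u₂ ∣ ≡ 1)

-- u lies in the closed triangle with vertices (0,0), (1,0), (r,n):
-- u is a convex combination λ₀·(0,0) + λ₁·(1,0) + λ₂·(r,n) with rational
-- λᵢ ≥ 0, Σλᵢ = 1; clearing denominators, λᵢ = aᵢ/d with aᵢ, d ∈ ℕ, d > 0.
InTriangle : (n r : ℕ) → ℤ² → Set
InTriangle n r u =
  Σ ℕ λ a₀ → Σ ℕ λ a₁ → Σ ℕ λ a₂ → Σ ℕ λ d →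
    (0 ℕ.< d) × (a₀ ℕ.+ a₁ ℕ.+ a₂ ≡ d) ×
    ((+ d) ·² u ≡ ((+ a₁) ·² (+ 1 , + 0)) +² ((+ a₂) ·² (+ r , + n)))

-- Projected to 𝕋², the black
-- vertices are bᵢ = (i/n, 0) and the white vertices are wᵢ = ((2i+1)/(2n), 0),
-- i ∈ Fin n.  Each white vertex wᵢ has exactly three incident edges:
--   e0 : wᵢ → bᵢ          (lift: to (i/n, j))
--   e1 : wᵢ → b_{i+1}     (lift: to ((i+1)/n, j))
--   e2 : wᵢ → b_{i+r}     (lift: to ((i+r)/n, j+1))
-- (indices mod n).  These are distinct edges even when endpoints coincide.
data EdgeType : Set where
  e0 e1 e2 : EdgeType

module Graph (n r : ℕ) .{{_ : NonZero n}} where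

  blackEnd : Fin n → EdgeType → Fin n
  blackEnd i e0 = i
  blackEnd i e1 = fromℕ< (m%n<n (toℕ i ℕ.+ 1) n)
  blackEnd i e2 = fromℕ< (m%n<n (toℕ i ℕ.+ r) n)

  -- displacement vector (white → black) of a lift of the edge, scaled by 2n
  disp2n : EdgeType → ℤ²
  disp2n e0 = (- (+ 1) , + 0)
  disp2n e1 = (+ 1 , + 0)
  disp2n e2 = ((+ (2 ℕ.* r)) - (+ 1) , + (2 ℕ.* n))

  -- Since each edge has exactly one white endpoint, this is the choice of one
  -- incident edge for each white vertex such that every black vertex is the
  -- black endpoint of exactly one chosen edge.
  record PerfectMatching : Set where
    field
      edge    : Fin n → EdgeType
      blackEx : ∀ (b : Fin n) → Σ (Fin n) λ w →
                  (blackEnd w (edge w) ≡ b) × (∀ w′ → blackEnd w′ (edge w′) ≡ b → w′ ≡ w)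

  ω₀-edge : Fin n → EdgeType
  ω₀-edge _ = e0

  -- 2n times the homology class of the 1-cycle ω − ω₀: the sum of the lifted
  -- displacement vectors of the edges of ω minus those of ω₀ (edges common to
  -- ω and ω₀ cancel, which is the same as discarding them).
  transitionDisp2n : PerfectMatching → ℤ²
  transitionDisp2n ω =
    sumFin n (λ i → disp2n (PerfectMatching.edge ω i) -² disp2n (ω₀-edge i))

  HasHeight : PerfectMatching → ℤ² → Set
  HasHeight ω u = transitionDisp2n ω ≡ ((+ (2 ℕ.* n)) ·² u)

-- Every lattice point u of the triangle T = conv{(0,0), (1,0), (r,n)} is the
-- height h_{ω₀}(ω) of a perfect matching ω of B̂(n,r).
--
-- Such a u is (q,b) with n·u = a·(1,0) + b·(r,n), a,b ≥ 0, a + b ≤ n, i.e.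
-- a + b·r = q·n.  Give vertex i the residue τ(i) = b·i mod n.  An edge of
-- type e1 (resp. e2) adds b (resp. b·r ≡ -a) to the residue, so choosing e1,
-- e2, e0 at the white residues [0,a), [a,a+b), [a+b,n) moves them onto the
-- black residues [b,a+b), [0,b), [a+b,n): an interval exchange, hence a
-- perfect matching.  Its height is ((#e1 + r·#e2)/n, #e2) = (q,b), since a
-- telescoping sum shows exactly c residues lie below c when c ≡ -b·s (mod n);
-- this applies to c = a and c = a + b, giving #e1 = a and #e2 = b.

module Submission where

open import Defs
open import Data.Nat using (ℕ; _<_; NonZero)
open import Data.Nat.GCD using (gcd)
open import Data.Product using (Σ)
open import Relation.Binary.PropositionalEquality using (_≡_)

open import Data.Nat using (zero; suc; _+_; _*_; _∸_; _≤_; z≤n; s≤s; _<?_; _≤?_)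
open import Data.Nat.Properties
open import Data.Nat.DivMod using (_%_; m%n<n; m<n⇒m%n≡m; [m+kn]%n≡m%n; [m+n]%n≡m%n;
  m≡m%n+[m/n]*n; %-distribˡ-+; m%n%n≡m%n; _/_)
open import Data.Nat.Tactic.RingSolver using (solve-∀)
open import Data.Fin using (Fin; toℕ; fromℕ<)
open import Data.Fin.Properties using (toℕ<n; toℕ-fromℕ<; toℕ-injective)
open import Data.Integer as ℤ using (-[1+_])
import Data.Integer.Properties as ℤP
import Data.Integer.Tactic.RingSolver as ℤSolver
open import Data.Product using (_,_; _×_; proj₁; proj₂)
open import Relation.Nullary using (Dec; yes; no; contradiction)
open import Relation.Binary.PropositionalEquality
  using (refl; sym; trans; cong; cong₂; subst; subst₂; module ≡-Reasoning)

open ≡-Reasoning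

sumN : ℕ → (ℕ → ℕ) → ℕ
sumN zero    F = 0
sumN (suc n) F = F 0 + sumN n (λ i → F (suc i))

sumN-cong : ∀ n {F G : ℕ → ℕ} → (∀ i → F i ≡ G i) → sumN n F ≡ sumN n G
sumN-cong zero    F≡G = refl
sumN-cong (suc n) F≡G = cong₂ _+_ (F≡G 0) (sumN-cong n (λ i → F≡G (suc i)))

sumN-+ : ∀ n F G → sumN n (λ i → F i + G i) ≡ sumN n F + sumN n G
sumN-+ zero    F G = refl
sumN-+ (suc n) F G = begin
    F 0 + G 0 + sumN n (λ i → F (suc i) + G (suc i))
  ≡⟨ cong (F 0 + G 0 +_) (sumN-+ n (λ i → F (suc i)) (λ i → G (suc i))) ⟩
    F 0 + G 0 + (sumN n (λ i → F (suc i)) + sumN n (λ i → G (suc i)))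
  ≡⟨ +-assoc-swap (F 0) (G 0) _ _ ⟩
    F 0 + sumN n (λ i → F (suc i)) + (G 0 + sumN n (λ i → G (suc i))) ∎
  where
  +-assoc-swap : ∀ w x y z → w + x + (y + z) ≡ w + y + (x + z)
  +-assoc-swap = solve-∀

sumN-* : ∀ n c F → sumN n (λ i → c * F i) ≡ c * sumN n F
sumN-* zero    c F = sym (*-zeroʳ c)
sumN-* (suc n) c F = trans (cong (c * F 0 +_) (sumN-* n c (λ i → F (suc i))))
                           (sym (*-distribˡ-+ c (F 0) _))

sumN-const : ∀ n c → sumN n (λ _ → c) ≡ n * c
sumN-const zero    c = refl
sumN-const (suc n) c = cong (c +_) (sumN-const n c)

sumN-last : ∀ n F → sumN (suc n) F ≡ sumN n F + F n
sumN-last zero    F = +-comm (F 0) 0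
sumN-last (suc n) F = trans (cong (F 0 +_) (sumN-last n (λ i → F (suc i))))
                            (sym (+-assoc (F 0) _ _))

sumN-window : ∀ n F → (∀ i → F (i + n) ≡ F i) →
              ∀ k → sumN n (λ i → F (k + i)) ≡ sumN n F
sumN-window n F periodic zero    = refl
sumN-window n F periodic (suc k) =
  trans (+-cancelˡ-≡ (F k) _ _ slide) (sumN-window n F periodic k)
  where
  -- both sides equal Σ_{i ≤ n} F (k + i)
  slide : F k + sumN n (λ i → F (suc k + i)) ≡ F k + sumN n (λ i → F (k + i))
  slide = begin
      F k + sumN n (λ i → F (suc k + i))
    ≡⟨ cong₂ _+_ (cong F (sym (+-identityʳ k))) (sumN-cong n (λ i → cong F (sym (+-suc k i)))) ⟩
      sumN (suc n) (λ i → F (k + i))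
    ≡⟨ sumN-last n (λ i → F (k + i)) ⟩
      sumN n (λ i → F (k + i)) + F (k + n)
    ≡⟨ cong (sumN n (λ i → F (k + i)) +_) (periodic k) ⟩
      sumN n (λ i → F (k + i)) + F k
    ≡⟨ +-comm _ (F k) ⟩
      F k + sumN n (λ i → F (k + i)) ∎

ind : ∀ {p} {P : Set p} → Dec P → ℕ
ind (yes _) = 1
ind (no _)  = 0

sumFin-cong : ∀ n {f g : Fin n → ℤ²} → (∀ i → f i ≡ g i) → sumFin n f ≡ sumFin n g
sumFin-cong zero    f≡g = refl
sumFin-cong (suc n) f≡g = cong₂ _+²_ (f≡g Data.Fin.zero) (sumFin-cong n (λ i → f≡g (Data.Fin.suc i)))

sumFin-ℕ : ∀ n (A B : ℕ → ℕ) →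
  sumFin n (λ i → (ℤ.+ A (toℕ i) , ℤ.+ B (toℕ i))) ≡ (ℤ.+ sumN n A , ℤ.+ sumN n B)
sumFin-ℕ zero    A B = refl
sumFin-ℕ (suc n) A B =
  cong ((ℤ.+ A 0 , ℤ.+ B 0) +²_) (sumFin-ℕ n (λ i → A (suc i)) (λ i → B (suc i)))

mod-unique : ∀ {n} .{{_ : NonZero n}} {x y} k → x ≡ y + k * n → y < n → x % n ≡ y
mod-unique {n} {y = y} k refl y<n = trans ([m+kn]%n≡m%n y k n) (m<n⇒m%n≡m y<n)

wrap-above : ∀ {n} .{{_ : NonZero n}} {t c x} k →
             c + x ≡ k * n → t < n → c ≤ t → (t + x) % n + c ≡ t
wrap-above {n} {t} {c} {x} k c+x≡kn t<n c≤t = begin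
    (t + x) % n + c ≡⟨ cong (_+ c) (mod-unique k split (≤-<-trans (m∸n≤m t c) t<n)) ⟩
    t ∸ c + c       ≡⟨ m∸n+n≡m c≤t ⟩
    t               ∎
  where
  split : t + x ≡ t ∸ c + k * n
  split = begin
    t + x           ≡⟨ cong (_+ x) (sym (m∸n+n≡m c≤t)) ⟩
    t ∸ c + c + x   ≡⟨ +-assoc (t ∸ c) c x ⟩
    t ∸ c + (c + x) ≡⟨ cong (t ∸ c +_) c+x≡kn ⟩
    t ∸ c + k * n   ∎

wrap-below : ∀ {n} .{{_ : NonZero n}} {t c x} k →
             c + x ≡ k * n → t < n → t < c → c ≤ n → (t + x) % n + c ≡ t + n
wrap-below {n} {t} {c} {x} zero c+x≡0 t<n t<c c≤n =
  contradiction (subst (t <_) (m+n≡0⇒m≡0 c c+x≡0) t<c) (λ ())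
wrap-below {n} {t} {c} {x} (suc k) c+x≡kn t<n t<c c≤n = begin
    (t + x) % n + c ≡⟨ cong (_+ c) (mod-unique k split t+e<n) ⟩
    t + e + c       ≡⟨ +-assoc t e c ⟩
    t + (e + c)     ≡⟨ cong (t +_) e+c≡n ⟩
    t + n           ∎
  where
  e : ℕ
  e = n ∸ c
  e+c≡n : e + c ≡ n
  e+c≡n = m∸n+n≡m c≤n
  t+e<n : t + e < n
  t+e<n = subst (t + e <_) (trans (+-comm c e) e+c≡n) (+-monoˡ-< e t<c)
  regroup₁ : ∀ t x c → t + x + c ≡ t + (c + x)
  regroup₁ = solve-∀
  regroup₂ : ∀ t e c kn → t + (e + c + kn) ≡ t + e + kn + c
  regroup₂ = solve-∀
  split : t + x ≡ t + e + k * n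
  split = +-cancelʳ-≡ c _ _ (begin
    t + x + c           ≡⟨ regroup₁ t x c ⟩
    t + (c + x)         ≡⟨ cong (t +_) c+x≡kn ⟩
    t + (n + k * n)     ≡⟨ cong (λ z → t + (z + k * n)) (sym e+c≡n) ⟩
    t + (e + c + k * n) ≡⟨ regroup₂ t e c (k * n) ⟩
    t + e + k * n + c   ∎)

module Residues (m b : ℕ) where

  n : ℕ
  n = suc m

  τ : ℕ → ℕ
  τ x = (b * x) % n

  τ<n : ∀ x → τ x < n
  τ<n x = m%n<n (b * x) n

  τ-mod : ∀ x → τ (x % n) ≡ τ x
  τ-mod x = sym (begin
    (b * x) % n                                ≡⟨ cong (λ z → (b * z) % n) (m≡m%n+[m/n]*n x n) ⟩
    (b * (x % n + x / n * n)) % n              ≡⟨ cong (_% n) (distribute b (x % n) (x / n) n) ⟩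
    (b * (x % n) + b * (x / n) * n) % n        ≡⟨ [m+kn]%n≡m%n (b * (x % n)) (b * (x / n)) n ⟩
    (b * (x % n)) % n                          ∎)
    where
    distribute : ∀ b y k n → b * (y + k * n) ≡ b * y + b * k * n
    distribute = solve-∀

  τ-shift : ∀ x k → τ (x + k) ≡ (τ x + b * k) % n
  τ-shift x k = begin
    (b * (x + k)) % n                ≡⟨ cong (_% n) (*-distribˡ-+ b x k) ⟩
    (b * x + b * k) % n              ≡⟨ %-distribˡ-+ (b * x) (b * k) n ⟩
    ((b * x) % n + (b * k) % n) % n  ≡⟨ cong (λ z → (z + (b * k) % n) % n) (sym (m%n%n≡m%n (b * x) n)) ⟩
    (τ x % n + (b * k) % n) % n      ≡⟨ sym (%-distribˡ-+ (τ x) (b * k) n) ⟩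
    (τ x + b * k) % n                ∎

  τ-periodic : ∀ x → τ (x + n) ≡ τ x
  τ-periodic x = trans (sym (τ-mod (x + n))) (trans (cong τ ([m+n]%n≡m%n x n)) (τ-mod x))

  countBelow : ℕ → ℕ
  countBelow c = sumN n (λ i → ind (τ i <? c))

  -- If c + b·s ≡ 0 (mod n) then exactly c of the residues τ(i) lie below c:
  -- τ(s + i) + c = τ(i) + n·[τ(i) < c], and summing over a period the τ-terms
  -- cancel.
  countBelow-exact : ∀ c s k → c ≤ n → c + b * s ≡ k * n → countBelow c ≡ c
  countBelow-exact c s k c≤n c+bs≡kn =
    sym (*-cancelˡ-≡ c (countBelow c) n (+-cancelˡ-≡ (sumN n τ) _ _ (begin
      sumN n τ + n * c                            ≡⟨ cong (_+ n * c) (sym (sumN-window n τ τ-periodic s)) ⟩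
      sumN n (λ i → τ (s + i)) + n * c            ≡⟨ cong (sumN n (λ i → τ (s + i)) +_) (sym (sumN-const n c)) ⟩
      sumN n (λ i → τ (s + i)) + sumN n (λ _ → c) ≡⟨ sym (sumN-+ n (λ i → τ (s + i)) (λ _ → c)) ⟩
      sumN n (λ i → τ (s + i) + c)                ≡⟨ sumN-cong n step ⟩
      sumN n (λ i → τ i + n * ind (τ i <? c))     ≡⟨ sumN-+ n τ (λ i → n * ind (τ i <? c)) ⟩
      sumN n τ + sumN n (λ i → n * ind (τ i <? c)) ≡⟨ cong (sumN n τ +_) (sumN-* n n (λ i → ind (τ i <? c))) ⟩
      sumN n τ + n * countBelow c                 ∎)))
    where
    step : ∀ i → τ (s + i) + c ≡ τ i + n * ind (τ i <? c)
    step i with τ i <? c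
    ... | yes τi<c = begin
      τ (s + i) + c          ≡⟨ cong (λ z → τ z + c) (+-comm s i) ⟩
      τ (i + s) + c          ≡⟨ cong (_+ c) (τ-shift i s) ⟩
      (τ i + b * s) % n + c  ≡⟨ wrap-below k c+bs≡kn (τ<n i) τi<c c≤n ⟩
      τ i + n                ≡⟨ cong (τ i +_) (sym (*-identityʳ n)) ⟩
      τ i + n * 1            ∎
    ... | no τi≮c = begin
      τ (s + i) + c          ≡⟨ cong (λ z → τ z + c) (+-comm s i) ⟩
      τ (i + s) + c          ≡⟨ cong (_+ c) (τ-shift i s) ⟩
      (τ i + b * s) % n + c  ≡⟨ wrap-above k c+bs≡kn (τ<n i) (≮⇒≥ τi≮c) ⟩
      τ i                    ≡⟨ sym (+-identityʳ (τ i)) ⟩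
      τ i + 0                ≡⟨ cong (τ i +_) (sym (*-zeroʳ n)) ⟩
      τ i + n * 0            ∎

rotate-back : ∀ {n} .{{_ : NonZero n}} k l x → k + l ≡ n → x < n → ((x + k) % n + l) % n ≡ x
rotate-back {n} k l x k+l≡n x<n = begin
  ((x + k) % n + l) % n        ≡⟨ %-distribˡ-+ ((x + k) % n) l n ⟩
  ((x + k) % n % n + l % n) % n ≡⟨ cong (λ z → (z + l % n) % n) (m%n%n≡m%n (x + k) n) ⟩
  ((x + k) % n + l % n) % n    ≡⟨ sym (%-distribˡ-+ (x + k) l n) ⟩
  (x + k + l) % n              ≡⟨ cong (_% n) (trans (+-assoc x k l) (cong (x +_) k+l≡n)) ⟩
  (x + n) % n                  ≡⟨ [m+n]%n≡m%n x n ⟩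
  x % n                        ≡⟨ m<n⇒m%n≡m x<n ⟩
  x                            ∎

module Matchings (m r : ℕ) (r<n : r < suc m) where

  private
    n : ℕ
    n = suc m

  open Graph n r

  shift : EdgeType → ℕ
  shift e0 = 0
  shift e1 = 1
  shift e2 = r

  shift≤n : ∀ e → shift e ≤ n
  shift≤n e0 = z≤n
  shift≤n e1 = s≤s z≤n
  shift≤n e2 = <⇒≤ r<n

  toℕ-blackEnd : ∀ w e → toℕ (blackEnd w e) ≡ (toℕ w + shift e) % n
  toℕ-blackEnd w e0 = sym (trans (cong (_% n) (+-identityʳ (toℕ w))) (m<n⇒m%n≡m (toℕ<n w)))
  toℕ-blackEnd w e1 = toℕ-fromℕ< (m%n<n (toℕ w + 1) n)
  toℕ-blackEnd w e2 = toℕ-fromℕ< (m%n<n (toℕ w + r) n)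

  source : EdgeType → Fin n → Fin n
  source e j = fromℕ< (m%n<n (toℕ j + (n ∸ shift e)) n)

  source-hit : ∀ e j → blackEnd (source e j) e ≡ j
  source-hit e j = toℕ-injective (begin
    toℕ (blackEnd (source e j) e)                        ≡⟨ toℕ-blackEnd (source e j) e ⟩
    (toℕ (source e j) + shift e) % n                     ≡⟨ cong (λ z → (z + shift e) % n) (toℕ-fromℕ< (m%n<n (toℕ j + (n ∸ shift e)) n)) ⟩
    ((toℕ j + (n ∸ shift e)) % n + shift e) % n          ≡⟨ rotate-back (n ∸ shift e) (shift e) (toℕ j) (m∸n+n≡m (shift≤n e)) (toℕ<n j) ⟩
    toℕ j                                                ∎)

  source-unique : ∀ e w j → blackEnd w e ≡ j → w ≡ source e j
  source-unique e w j refl = toℕ-injective (sym (begin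
    toℕ (source e (blackEnd w e))                        ≡⟨ toℕ-fromℕ< (m%n<n (toℕ (blackEnd w e) + (n ∸ shift e)) n) ⟩
    (toℕ (blackEnd w e) + (n ∸ shift e)) % n             ≡⟨ cong (λ z → (z + (n ∸ shift e)) % n) (toℕ-blackEnd w e) ⟩
    ((toℕ w + shift e) % n + (n ∸ shift e)) % n          ≡⟨ rotate-back (shift e) (n ∸ shift e) (toℕ w) (m+[n∸m]≡n (shift≤n e)) (toℕ<n w) ⟩
    toℕ w                                                ∎))

  fromLabels : (edge κ : Fin n → EdgeType) →
               (∀ w → κ (blackEnd w (edge w)) ≡ edge w) →
               (∀ w e → κ (blackEnd w e) ≡ e → edge w ≡ e) →
               PerfectMatching
  fromLabels edge κ labelled detects = record { edge = edge ; blackEx = cover }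
    where
    cover : ∀ j → Σ (Fin n) λ w →
              (blackEnd w (edge w) ≡ j) × (∀ w′ → blackEnd w′ (edge w′) ≡ j → w′ ≡ w)
    cover j = w , hit , unique
      where
      w : Fin n
      w = source (κ j) j
      uses : edge w ≡ κ j
      uses = detects w (κ j) (cong κ (source-hit (κ j) j))
      hit : blackEnd w (edge w) ≡ j
      hit = trans (cong (blackEnd w) uses) (source-hit (κ j) j)
      unique : ∀ w′ → blackEnd w′ (edge w′) ≡ j → w′ ≡ w
      unique w′ covers = source-unique (κ j) w′ j
        (subst (λ e → blackEnd w′ e ≡ j) (trans (sym (labelled w′)) (cong κ covers)) covers)

-- The interval-exchange matching attached to a point u = (q,b) of the
-- triangle with third coordinate a: a + b·r = q·n and a + b ≤ n.
module IntervalExchange (m r q b a : ℕ) (r<n : r < suc m)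
                        (fits : a + b ≤ suc m) (balance : a + b * r ≡ q * suc m) where

  open Residues m b
  open Graph n r
  open Matchings m r r<n

  a≤n : a ≤ n
  a≤n = ≤-trans (m≤m+n a b) fits

  b≤n : b ≤ n
  b≤n = ≤-trans (m≤n+m b a) fits

  -- The residue intervals of the white vertices using each edge type ...
  Src : EdgeType → ℕ → Set
  Src e1 t = t < a
  Src e2 t = a ≤ t × t < a + b
  Src e0 t = a + b ≤ t

  -- ... and of the black vertices they are matched to.
  Dst : EdgeType → ℕ → Set
  Dst e1 y = b ≤ y × y < a + b
  Dst e2 y = y < b
  Dst e0 y = a + b ≤ y

  classify : ℕ → EdgeType
  classify t with t <? a | t <? a + b
  ... | yes _ | _     = e1
  ... | no _  | yes _ = e2
  ... | no _  | no _  = e0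

  classify-spec : ∀ t → Src (classify t) t
  classify-spec t with t <? a | t <? a + b
  ... | yes t<a | _        = t<a
  ... | no t≮a  | yes t<ab = ≮⇒≥ t≮a , t<ab
  ... | no _    | no t≮ab  = ≮⇒≥ t≮ab

  classify-intro : ∀ e t → Src e t → classify t ≡ e
  classify-intro e1 t t<a with t <? a
  ... | yes _  = refl
  ... | no t≮a = contradiction t<a t≮a
  classify-intro e2 t (a≤t , t<ab) with t <? a | t <? a + b
  ... | yes t<a | _       = contradiction t<a (≤⇒≯ a≤t)
  ... | no _    | yes _   = refl
  ... | no _    | no t≮ab = contradiction t<ab t≮ab
  classify-intro e0 t ab≤t with t <? a | t <? a + b
  ... | yes t<a | _        = contradiction (<-≤-trans t<a (m≤m+n a b)) (≤⇒≯ ab≤t)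
  ... | no _    | yes t<ab = contradiction t<ab (≤⇒≯ ab≤t)
  ... | no _    | no _     = refl

  zone : ℕ → EdgeType
  zone y with y <? b | y <? a + b
  ... | yes _ | _     = e2
  ... | no _  | yes _ = e1
  ... | no _  | no _  = e0

  zone-spec : ∀ y → Dst (zone y) y
  zone-spec y with y <? b | y <? a + b
  ... | yes y<b | _        = y<b
  ... | no y≮b  | yes y<ab = ≮⇒≥ y≮b , y<ab
  ... | no _    | no y≮ab  = ≮⇒≥ y≮ab

  zone-intro : ∀ e y → Dst e y → zone y ≡ e
  zone-intro e2 y y<b with y <? b
  ... | yes _  = refl
  ... | no y≮b = contradiction y<b y≮b
  zone-intro e1 y (b≤y , y<ab) with y <? b | y <? a + b
  ... | yes y<b | _       = contradiction y<b (≤⇒≯ b≤y)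
  ... | no _    | yes _   = refl
  ... | no _    | no y≮ab = contradiction y<ab y≮ab
  zone-intro e0 y ab≤y with y <? b | y <? a + b
  ... | yes y<b | _        = contradiction (<-≤-trans y<b (m≤n+m b a)) (≤⇒≯ ab≤y)
  ... | no _    | yes y<ab = contradiction y<ab (≤⇒≯ ab≤y)
  ... | no _    | no _     = refl

  move : EdgeType → ℕ → ℕ
  move e t = (t + b * shift e) % n

  τ-blackEnd : ∀ w e → τ (toℕ (blackEnd w e)) ≡ move e (τ (toℕ w))
  τ-blackEnd w e = begin
    τ (toℕ (blackEnd w e))       ≡⟨ cong τ (toℕ-blackEnd w e) ⟩
    τ ((toℕ w + shift e) % n)    ≡⟨ τ-mod (toℕ w + shift e) ⟩
    τ (toℕ w + shift e)          ≡⟨ τ-shift (toℕ w) (shift e) ⟩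
    move e (τ (toℕ w))           ∎

  move-e0 : ∀ {t} → t < n → move e0 t ≡ t
  move-e0 {t} t<n = begin
    (t + b * 0) % n ≡⟨ cong (λ z → (t + z) % n) (*-zeroʳ b) ⟩
    (t + 0) % n     ≡⟨ cong (_% n) (+-identityʳ t) ⟩
    t % n           ≡⟨ m<n⇒m%n≡m t<n ⟩
    t               ∎

  -- e1 adds b ≡ -(n - b); e2 adds b·r ≡ -a.
  e1-balance : n ∸ b + b * 1 ≡ 1 * n
  e1-balance = trans (cong (n ∸ b +_) (*-identityʳ b)) (trans (m∸n+n≡m b≤n) (sym (*-identityˡ n)))

  e1-below : ∀ {t} → t < n → t < n ∸ b → move e1 t ≡ t + b
  e1-below {t} t<n t<n∸b = +-cancelʳ-≡ (n ∸ b) _ _ (begin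
    move e1 t + (n ∸ b) ≡⟨ wrap-below 1 e1-balance t<n t<n∸b (m∸n≤m n b) ⟩
    t + n               ≡⟨ cong (t +_) (sym (m+[n∸m]≡n b≤n)) ⟩
    t + (b + (n ∸ b))   ≡⟨ sym (+-assoc t b (n ∸ b)) ⟩
    t + b + (n ∸ b)     ∎)

  e1-above : ∀ {t} → t < n → n ∸ b ≤ t → move e1 t < b
  e1-above t<n n∸b≤t = +-cancelʳ-< (n ∸ b) _ b
    (subst₂ _<_ (sym (wrap-above 1 e1-balance t<n n∸b≤t)) (sym (m+[n∸m]≡n b≤n)) t<n)

  e2-above : ∀ {t} → t < n → a ≤ t → move e2 t + a ≡ t
  e2-above t<n a≤t = wrap-above q balance t<n a≤t

  e2-below : ∀ {t} → t < n → t < a → move e2 t + a ≡ t + n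
  e2-below t<n t<a = wrap-below q balance t<n t<a a≤n

  exchange-fwd : ∀ e t → t < n → Src e t → Dst e (move e t)
  exchange-fwd e0 t t<n ab≤t = subst (a + b ≤_) (sym (move-e0 t<n)) ab≤t
  exchange-fwd e1 t t<n t<a =
    subst (b ≤_) (sym moved) (m≤n+m b t) , subst (_< a + b) (sym moved) (+-monoˡ-< b t<a)
    where
    moved : move e1 t ≡ t + b
    moved = e1-below t<n (<-≤-trans t<a (m+n≤o⇒m≤o∸n a fits))
  exchange-fwd e2 t t<n (a≤t , t<ab) =
    +-cancelʳ-< a _ b (subst₂ _<_ (sym (e2-above t<n a≤t)) (+-comm a b) t<ab)

  exchange-bwd : ∀ e t → t < n → Dst e (move e t) → Src e t
  exchange-bwd e0 t t<n ab≤y = subst (a + b ≤_) (move-e0 t<n) ab≤y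
  exchange-bwd e1 t t<n (b≤y , y<ab) with t <? n ∸ b
  ... | yes t<n∸b = +-cancelʳ-< b t a (subst (_< a + b) (e1-below t<n t<n∸b) y<ab)
  ... | no t≮n∸b  = contradiction (e1-above t<n (≮⇒≥ t≮n∸b)) (≤⇒≯ b≤y)
  exchange-bwd e2 t t<n y<b with a ≤? t
  ... | yes a≤t = a≤t , subst (_< a + b) (e2-above t<n a≤t)
                          (subst (move e2 t + a <_) (+-comm b a) (+-monoˡ-< a y<b))
  ... | no a≰t  = contradiction (+-cancelʳ-≤ a b (move e2 t) wrapped) (<⇒≱ y<b)
    where
    wrapped : b + a ≤ move e2 t + a
    wrapped = ≤-trans (subst (_≤ n) (+-comm a b) fits)
                      (subst (n ≤_) (sym (e2-below t<n (≰⇒> a≰t))) (m≤n+m n t))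

  edge : Fin n → EdgeType
  edge w = classify (τ (toℕ w))

  label : Fin n → EdgeType
  label j = zone (τ (toℕ j))

  labelled : ∀ w → label (blackEnd w (edge w)) ≡ edge w
  labelled w = trans (cong zone (τ-blackEnd w (edge w)))
    (zone-intro (edge w) _ (exchange-fwd (edge w) _ (τ<n (toℕ w)) (classify-spec (τ (toℕ w)))))

  detects : ∀ w e → label (blackEnd w e) ≡ e → edge w ≡ e
  detects w e labelled-e = classify-intro e t (exchange-bwd e t (τ<n (toℕ w))
    (subst (Dst e) (τ-blackEnd w e) (subst (λ e′ → Dst e′ y) labelled-e (zone-spec y))))
    where
    t : ℕ
    t = τ (toℕ w)
    y : ℕ
    y = τ (toℕ (blackEnd w e))

  matching : PerfectMatching
  matching = fromLabels edge label labelled detects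

  count-a : countBelow a ≡ a
  count-a = countBelow-exact a r q a≤n balance

  count-ab : countBelow (a + b) ≡ a + b
  count-ab = countBelow-exact (a + b) (r + m) (q + b) fits (begin
    a + b + b * (r + m)      ≡⟨ regroup a b r m ⟩
    a + b * r + b * n        ≡⟨ cong (_+ b * n) balance ⟩
    q * n + b * n            ≡⟨ sym (*-distribʳ-+ n q b) ⟩
    (q + b) * n              ∎)
    where
    regroup : ∀ a b r m → a + b + b * (r + m) ≡ a + b * r + b * suc m
    regroup = solve-∀

  weigh : ℕ → ℕ → EdgeType → ℕ
  weigh p w e0 = 0
  weigh p w e1 = p
  weigh p w e2 = w

  weigh-classify : ∀ p w t →
    weigh p w (classify t) + w * ind (t <? a) ≡ p * ind (t <? a) + w * ind (t <? a + b)
  weigh-classify p w t with t <? a | t <? a + b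
  ... | yes _   | yes _   = in-e1 p w
    where
    in-e1 : ∀ p w → p + w * 1 ≡ p * 1 + w * 1
    in-e1 = solve-∀
  ... | yes t<a | no t≮ab = contradiction (<-≤-trans t<a (m≤m+n a b)) t≮ab
  ... | no _    | yes _   = in-e2 p w
    where
    in-e2 : ∀ p w → w + w * 0 ≡ p * 0 + w * 1
    in-e2 = solve-∀
  ... | no _    | no _    = in-e0 p w
    where
    in-e0 : ∀ p w → 0 + w * 0 ≡ p * 0 + w * 0
    in-e0 = solve-∀

  total-weight : ∀ p w → sumN n (λ i → weigh p w (classify (τ i))) ≡ p * a + w * b
  total-weight p w = +-cancelʳ-≡ (w * a) _ _ (begin
      S + w * a
    ≡⟨ cong (λ z → S + w * z) (sym count-a) ⟩
      S + w * countBelow a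
    ≡⟨ cong (S +_) (sym (sumN-* n w (λ i → ind (τ i <? a)))) ⟩
      S + sumN n (λ i → w * ind (τ i <? a))
    ≡⟨ sym (sumN-+ n (λ i → weigh p w (classify (τ i))) (λ i → w * ind (τ i <? a))) ⟩
      sumN n (λ i → weigh p w (classify (τ i)) + w * ind (τ i <? a))
    ≡⟨ sumN-cong n (λ i → weigh-classify p w (τ i)) ⟩
      sumN n (λ i → p * ind (τ i <? a) + w * ind (τ i <? a + b))
    ≡⟨ sumN-+ n (λ i → p * ind (τ i <? a)) (λ i → w * ind (τ i <? a + b)) ⟩
      sumN n (λ i → p * ind (τ i <? a)) + sumN n (λ i → w * ind (τ i <? a + b))
    ≡⟨ cong₂ _+_ (sumN-* n p (λ i → ind (τ i <? a))) (sumN-* n w (λ i → ind (τ i <? a + b))) ⟩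
      p * countBelow a + w * countBelow (a + b)
    ≡⟨ cong₂ (λ x y → p * x + w * y) count-a count-ab ⟩
      p * a + w * (a + b)
    ≡⟨ regroup p w a b ⟩
      p * a + w * b + w * a ∎)
    where
    S : ℕ
    S = sumN n (λ i → weigh p w (classify (τ i)))
    regroup : ∀ p w a b → p * a + w * (a + b) ≡ p * a + w * b + w * a
    regroup = solve-∀

  edge-displacement : ∀ e → disp2n e -² disp2n e0 ≡ (ℤ.+ weigh 2 (2 * r) e , ℤ.+ weigh 0 (2 * n) e)
  edge-displacement e0 = refl
  edge-displacement e1 = refl
  edge-displacement e2 = cong₂ _,_ (cancel-unit (ℤ.+ (2 * r))) (ℤP.+-identityʳ (ℤ.+ (2 * n)))
    where
    cancel-unit : ∀ x → (x ℤ.- ℤ.+ 1) ℤ.- (ℤ.- (ℤ.+ 1)) ≡ x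
    cancel-unit = ℤSolver.solve-∀

  height : HasHeight matching (ℤ.+ q , ℤ.+ b)
  height = begin
      transitionDisp2n matching
    ≡⟨ sumFin-cong n (λ i → edge-displacement (edge i)) ⟩
      sumFin n (λ i → (ℤ.+ weigh 2 (2 * r) (edge i) , ℤ.+ weigh 0 (2 * n) (edge i)))
    ≡⟨ sumFin-ℕ n (λ i → weigh 2 (2 * r) (classify (τ i))) (λ i → weigh 0 (2 * n) (classify (τ i))) ⟩
      (ℤ.+ sumN n (λ i → weigh 2 (2 * r) (classify (τ i))) , ℤ.+ sumN n (λ i → weigh 0 (2 * n) (classify (τ i))))
    ≡⟨ cong₂ _,_ (cong ℤ.+_ (trans (total-weight 2 (2 * r)) horizontal))
                 (cong ℤ.+_ (total-weight 0 (2 * n))) ⟩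
      (ℤ.+ (2 * n * q) , ℤ.+ (2 * n * b))
    ≡⟨ cong₂ _,_ (ℤP.pos-* (2 * n) q) (ℤP.pos-* (2 * n) b) ⟩
      (ℤ.+ (2 * n) ℤ.* ℤ.+ q , ℤ.+ (2 * n) ℤ.* ℤ.+ b) ∎
    where
    horizontal : 2 * a + 2 * r * b ≡ 2 * n * q
    horizontal = begin
      2 * a + 2 * r * b ≡⟨ double-balance a b r ⟩
      2 * (a + b * r)   ≡⟨ cong (2 *_) balance ⟩
      2 * (q * n)       ≡⟨ reorder q n ⟩
      2 * n * q         ∎
      where
      double-balance : ∀ a b r → 2 * a + 2 * r * b ≡ 2 * (a + b * r)
      double-balance = solve-∀
      reorder : ∀ q n → 2 * (q * n) ≡ 2 * n * q
      reorder = solve-∀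

-- Lattice points of the triangle with vertices (0,0), (1,0), (r,n):
-- u = (q,b) with n·u = a·(1,0) + b·(r,n) + (n − a − b)·(0,0).
record LatticePoint (n r : ℕ) (u : ℤ²) : Set where
  field
    q b a   : ℕ
    coords  : u ≡ (ℤ.+ q , ℤ.+ b)
    fits    : a + b ≤ n
    balance : a + b * r ≡ q * n

barycentric : ∀ n r q b a₁ a₂ d .{{_ : NonZero d}} → a₁ + a₂ ≤ d →
  d * q ≡ a₁ * 1 + a₂ * r → d * b ≡ a₁ * 0 + a₂ * n →
  Σ ℕ λ a → (a + b * r ≡ q * n) × (a + b ≤ n)
barycentric n r q b a₁ a₂ d a₁₂≤d x-eq y-eq = a , balance , fits
  where
  scaled : d * (q * n) ≡ n * a₁ + d * (b * r)
  scaled = begin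
    d * (q * n)                    ≡⟨ reorder d q n ⟩
    n * (d * q)                    ≡⟨ cong (n *_) x-eq ⟩
    n * (a₁ * 1 + a₂ * r)          ≡⟨ expand n a₁ a₂ r ⟩
    n * a₁ + (a₁ * 0 + a₂ * n) * r ≡⟨ cong (λ z → n * a₁ + z * r) (sym y-eq) ⟩
    n * a₁ + d * b * r             ≡⟨ cong (n * a₁ +_) (*-assoc d b r) ⟩
    n * a₁ + d * (b * r)           ∎
    where
    reorder : ∀ d q n → d * (q * n) ≡ n * (d * q)
    reorder = solve-∀
    expand : ∀ n a₁ a₂ r → n * (a₁ * 1 + a₂ * r) ≡ n * a₁ + (a₁ * 0 + a₂ * n) * r
    expand = solve-∀
  br≤qn : b * r ≤ q * n
  br≤qn = *-cancelˡ-≤ d (subst (d * (b * r) ≤_) (sym scaled) (m≤n+m _ _))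
  a : ℕ
  a = q * n ∸ b * r
  balance : a + b * r ≡ q * n
  balance = m∸n+n≡m br≤qn
  scaled-a : d * a ≡ n * a₁
  scaled-a = +-cancelʳ-≡ (d * (b * r)) _ _
    (trans (sym (*-distribˡ-+ d a (b * r))) (trans (cong (d *_) balance) scaled))
  scaled-fit : d * (a + b) ≡ n * (a₁ + a₂)
  scaled-fit = trans (*-distribˡ-+ d a b) (trans (cong₂ _+_ scaled-a y-eq) (collect n a₁ a₂))
    where
    collect : ∀ n a₁ a₂ → n * a₁ + (a₁ * 0 + a₂ * n) ≡ n * (a₁ + a₂)
    collect = solve-∀
  fits : a + b ≤ n
  fits = *-cancelˡ-≤ d (subst (_≤ d * n) (sym scaled-fit)
                             (subst (n * (a₁ + a₂) ≤_) (*-comm n d) (*-monoʳ-≤ n a₁₂≤d)))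

pos-combination : ∀ a₁ a₂ x y → (ℤ.+ a₁ ℤ.* ℤ.+ x) ℤ.+ (ℤ.+ a₂ ℤ.* ℤ.+ y) ≡ ℤ.+ (a₁ * x + a₂ * y)
pos-combination a₁ a₂ x y =
  sym (trans (ℤP.pos-+ (a₁ * x) (a₂ * y)) (cong₂ ℤ._+_ (ℤP.pos-* a₁ x) (ℤP.pos-* a₂ y)))

-- A point of the triangle is a lattice point in the above sense; its
-- coordinates are non-negative since d·u is a non-negative combination.
latticePoint : ∀ n r u → InTriangle n r u → LatticePoint n r u
latticePoint n r u (a₀ , a₁ , a₂ , zero , () , _)
latticePoint n r (u₁ , -[1+ k ]) (a₀ , a₁ , a₂ , suc d , _ , _ , eq) =
  contradiction (trans (cong proj₂ eq) (pos-combination a₁ a₂ 0 n)) (λ ())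
latticePoint n r (-[1+ k ] , u₂) (a₀ , a₁ , a₂ , suc d , _ , _ , eq) =
  contradiction (trans (cong proj₁ eq) (pos-combination a₁ a₂ 1 r)) (λ ())
latticePoint n r (ℤ.+ q , ℤ.+ b) (a₀ , a₁ , a₂ , suc d , _ , sum≡d , eq) =
  point (barycentric n r q b a₁ a₂ (suc d) a₁₂≤d x-eq y-eq)
  where
  a₁₂≤d : a₁ + a₂ ≤ suc d
  a₁₂≤d = subst (a₁ + a₂ ≤_) (trans (sym (+-assoc a₀ a₁ a₂)) sum≡d) (m≤n+m (a₁ + a₂) a₀)
  x-eq : suc d * q ≡ a₁ * 1 + a₂ * r
  x-eq = ℤP.+-injective (trans (ℤP.pos-* (suc d) q) (trans (cong proj₁ eq) (pos-combination a₁ a₂ 1 r)))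
  y-eq : suc d * b ≡ a₁ * 0 + a₂ * n
  y-eq = ℤP.+-injective (trans (ℤP.pos-* (suc d) b) (trans (cong proj₂ eq) (pos-combination a₁ a₂ 0 n)))
  point : (Σ ℕ λ a → (a + b * r ≡ q * n) × (a + b ≤ n)) → LatticePoint n r (ℤ.+ q , ℤ.+ b)
  point (a , balance , fits) = record { q = q ; b = b ; a = a ; coords = refl ; fits = fits ; balance = balance }

mainTheorem2 : (n r : ℕ) → .{{_ : NonZero n}} → r < n → gcd r n ≡ 1 →
    (u : ℤ²) → Visible u → InTriangle n r u →
    Σ (Graph.PerfectMatching n r) λ ω → Graph.HasHeight n r ω u
mainTheorem2 zero    r ()
mainTheorem2 (suc m) r r<n _ u _ u∈T with latticePoint (suc m) r u u∈T
... | record { q = q ; b = b ; a = a ; coords = refl ; fits = fits ; balance = balance } =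
  matching , height
  where open IntervalExchange m r q b a r<n fits balance
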